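{- If $\Gamma\vdash\lambda x.\mathbf t:T$ is derivable in $\lambda^{\mathrm{vec}}_{\mathrm R}$, then there exist types $T_1,\dots,T_n$, $R_1,\dots,R_n$, unit types $U_1,\dots,U_n$, scalars $\alpha_1,\dots,\alpha_n$ and sets of type variables $\mathcal V_1,\dots,\mathcal V_n$ such that $T\equiv\sum_{i=1}^n\alpha_i\cdot T_i$, $\sum_{i=1}^n\alpha_i=1$, and for all $i\in\{1,\dots,n\}$: $\Gamma,x:U_i\vdash\mathbf t:R_i$ is derivable and $U_i\to R_i\preceq_{\mathcal V_i,\Gamma}T_i$.
   Context: Fix a commutative ring $(\mathsf S,+,\times)$ of scalars. Terms: $\mathbf t ::= x\mid \lambda x.\mathbf t\mid (\mathbf t)\,\mathbf t\mid \alpha\cdot\mathbf t\mid \mathbf t+\mathbf t$. Types: general $T::=U\mid\alpha\cdot T\mid T+T\mid\mathbb X$, unit $U::=X\mid U\to T\mid\forall X.U\mid\forall\mathbb X.U$ ($X$ unit type variables, $\mathbb X$ general type variables). $\equiv$ is the smallest congruence with $1\cdot T\equiv T$, $\alpha\cdot(\beta\cdot T)\equiv(\alpha\times\beta)\cdot T$, $\alpha\cdot T+\alpha\cdot R\equiv\alpha\cdot(T+R)$, $\alpha\cdot T+\beta\cdot T\equiv(\alpha+\beta)\cdot T$, $T+R\equiv R+T$, $T+(R+S)\equiv(T+R)+S$. In $T[A/X]$, $A$ is unit when $X$ is a unit variable. Typing rules (contexts: finite sets of $x:U$, $U$ unit): (ax) $\Gamma,x:U\vdash x:U$; ($\equiv$)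 from $\Gamma\vdash\mathbf t:T$, $R\equiv T$ infer $\Gamma\vdash\mathbf t:R$; ($\to_I$) from $\Gamma,x:U\vdash\mathbf t:T$ infer $\Gamma\vdash\lambda x.\mathbf t:U\to T$; ($\to_E$) from $\Gamma\vdash\mathbf t:\sum_{i=1}^n\alpha_i\cdot\forall\vec X.(U\to T_i)$ and $\Gamma\vdash\mathbf r:\sum_{j=1}^m\beta_j\cdot U[\vec A_j/\vec X]$ infer $\Gamma\vdash(\mathbf t)\,\mathbf r:\sum_{i}\sum_{j}(\alpha_i\times\beta_j)\cdot T_i[\vec A_j/\vec X]$; ($\forall_I$) from $\Gamma\vdash\mathbf t:\sum_i\alpha_i\cdot U_i$, $X\notin FV(\Gamma)$ infer $\Gamma\vdash\mathbf t:\sum_i\alpha_i\cdot\forall X.U_i$; ($\forall_E$) from $\Gamma\vdash\mathbf t:\sum_i\alpha_i\cdot\forall X.U_i$ infer $\Gamma\vdash\mathbf t:\sum_i\alpha_i\cdot U_i[A/X]$; ($+_I$) from $\Gamma\vdash\mathbf t:T$, $\Gamma\vdash\mathbf r:R$ infer $\Gamma\vdash\mathbf t+\mathbf r:T+R$; ($1_E$) from $\Gamma\vdash1\cdot\mathbf t:T$ infer $\Gamma\vdash\mathbf t:T$; ($S$) from $\Gamma\vdash\mathbf t:T_i$ for all $i$ infer $\Gamma\vdash(\sum_i\alpha_i)\cdot\mathbf t:\sum_i\alpha_i\cdot T_i$. Ordering: for types $T,R$ and a context $\Gamma$ such that, for some term $\mathbf t$, $\Gamma\vdash\mathbf t:T$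 can be derived from $\Gamma\vdash\mathbf t:R$ without extra hypotheses: (1) if $X\notin FV(\Gamma)$, $R\prec_{X,\Gamma}T$ means either $R\equiv\sum_{i}\alpha_i\cdot U_i$ and $T\equiv\sum_{i}\alpha_i\cdot\forall X.U_i$, or $R\equiv\sum_i\alpha_i\cdot\forall X.U_i$ and $T\equiv\sum_i\alpha_i\cdot U_i[A/X]$; (2) for $\mathcal V$ with $\mathcal V\cap FV(\Gamma)=\emptyset$, $\preceq_{\mathcal V,\Gamma}$ is inductively defined by: $R\prec_{X,\Gamma}T$ implies $R\preceq_{\mathcal V\cup\{X\},\Gamma}T$; if $\mathcal V_1,\mathcal V_2\subseteq\mathcal V$, $S\preceq_{\mathcal V_1,\Gamma}R$ and $R\preceq_{\mathcal V_2,\Gamma}T$ then $S\preceq_{\mathcal V_1\cup\mathcal V_2,\Gamma}T$; $R\equiv T$ implies $R\preceq_{\mathcal V,\Gamma}T$. -}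

module Defs where

open import Level using (_⊔_)
open import Algebra.Bundles using (CommutativeRing)
open import Data.Nat as ℕ using (ℕ; suc)
open import Data.Fin using (Fin; zero; suc)
open import Data.List using (List; []; _∷_; _++_; concatMap; map; foldr)
open import Data.List.Relation.Unary.All using (All; []; _∷_)
open import Data.List.Membership.Propositional using (_∈_; _∉_)
open import Data.Product using (_×_; _,_; proj₂)
open import Relation.Nullary using (Dec; yes; no; ¬_)
open import Relation.Binary.PropositionalEquality using (_≡_; _≢_; refl; cong)

-- Type variables: unit type variables X and general type variables 𝕏.

data TV : Set where
  uv : ℕ → TV
  gv : ℕ → TV

_≟TV_ : (X Y : TV) → Dec (X ≡ Y)
uv n ≟TV uv m with n ℕ.≟ m
... | yes refl = yes refl
... | no n≢m = no λ { refl → n≢m refl }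
uv n ≟TV gv m = no λ ()
gv n ≟TV uv m = no λ ()
gv n ≟TV gv m with n ℕ.≟ m
... | yes refl = yes refl
... | no n≢m = no λ { refl → n≢m refl }

withName : TV → ℕ → TV
withName (uv _) k = uv k
withName (gv _) k = gv k

name : TV → ℕ
name (uv n) = n
name (gv n) = n

remove : TV → List TV → List TV
remove X [] = []
remove X (Y ∷ Ys) with X ≟TV Y
... | yes _ = remove X Ys
... | no  _ = Y ∷ remove X Ys

freshName : List TV → ℕ
freshName Xs = suc (foldr (λ X k → name X ℕ.⊔ k) 0 Xs)

module Lambda {c ℓ} (Ring : CommutativeRing c ℓ) where

  open CommutativeRing Ring public using (_≈_; _+_; _*_; 1#) renaming (Carrier to S)

  data Tm : Set c where
    `_  : ℕ → Tm
    ƛ   : ℕ → Tm → Tm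
    _∙_ : Tm → Tm → Tm
    _⊛_ : S → Tm → Tm
    _⊹_ : Tm → Tm → Tm

  -- Types  U ::= X | U → T | ∀X.U | ∀𝕏.U ;  T ::= U | α·T | T+T | 𝕏

  mutual
    data UTy : Set c where
      tvar : ℕ → UTy
      _⇒_  : UTy → Ty → UTy
      Π    : TV → UTy → UTy        -- ∀X.U  (Π (uv n))  or  ∀𝕏.U  (Π (gv n))

    data Ty : Set c where
      ⌜_⌝  : UTy → Ty
      _·_  : S → Ty → Ty
      _⊕_  : Ty → Ty → Ty
      gvar : ℕ → Ty

  infixr 6 _⊕_
  infixr 7 _·_

  Arg : TV → Set c
  Arg (uv _) = UTy
  Arg (gv _) = Ty

  varArg : (X : TV) → ℕ → Arg X
  varArg (uv _) k = tvar k
  varArg (gv _) k = gvar k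

  mutual
    fvU : UTy → List TV
    fvU (tvar n) = uv n ∷ []
    fvU (A ⇒ T) = fvU A ++ fvT T
    fvU (Π X A) = remove X (fvU A)

    fvT : Ty → List TV
    fvT ⌜ A ⌝ = fvU A
    fvT (α · T) = fvT T
    fvT (T ⊕ R) = fvT T ++ fvT R
    fvT (gvar n) = gv n ∷ []

  fvArg : (X : TV) → Arg X → List TV
  fvArg (uv _) A = fvU A
  fvArg (gv _) T = fvT T

  -- Capture-avoiding simultaneous substitution (Stoughton style).

  Sub : Set c
  Sub = (X : TV) → Arg X

  idSub : Sub
  idSub (uv n) = tvar n
  idSub (gv n) = gvar n

  _,,_↦_ : Sub → (X : TV) → Arg X → Sub
  (σ ,, X ↦ a) Y with Y ≟TV X
  ... | yes refl = a
  ... | no  _    = σ Y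

  mutual
    substU : Sub → UTy → UTy
    substU σ (tvar n) = σ (uv n)
    substU σ (A ⇒ T) = substU σ A ⇒ substT σ T
    substU σ (Π X A) =
      let k = freshName (concatMap (λ W → fvArg W (σ W)) (fvU (Π X A)))
      in Π (withName X k) (substU (σ ,, X ↦ varArg X k) A)

    substT : Sub → Ty → Ty
    substT σ ⌜ A ⌝ = ⌜ substU σ A ⌝
    substT σ (α · T) = α · substT σ T
    substT σ (T ⊕ R) = substT σ T ⊕ substT σ R
    substT σ (gvar n) = σ (gv n)

  _[_≔_] : UTy → (X : TV) → Arg X → UTy
  A [ X ≔ B ] = substU (idSub ,, X ↦ B) A

  Πs : List TV → UTy → UTy
  Πs Xs A = foldr Π A Xs

  subAll : (Xs : List TV) → All Arg Xs → Sub
  subAll [] [] = idSub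
  subAll (X ∷ Xs) (a ∷ as) = subAll Xs as ,, X ↦ a

  -- Finite non-empty sums  Σ_{i=1}^{n} (n ≥ 1, indices Fin (suc n))

  ΣT : ∀ {n} → (Fin (suc n) → Ty) → Ty
  ΣT {ℕ.zero} f = f zero
  ΣT {suc n}  f = f zero ⊕ ΣT (λ i → f (suc i))

  Σs : ∀ {n} → (Fin (suc n) → S) → S
  Σs {ℕ.zero} f = f zero
  Σs {suc n}  f = f zero + Σs (λ i → f (suc i))

  -- Type equivalence ≡: the smallest congruence containing the listed
  -- axioms (types being taken modulo α-conversion of ∀-binders, and
  -- scalars modulo the ring equality).

  infix 4 _≅U_ _≅T_
  mutual
    data _≅U_ : UTy → UTy → Set (c ⊔ ℓ) where
      reflU  : ∀ {A} → A ≅U A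
      symU   : ∀ {A B} → A ≅U B → B ≅U A
      transU : ∀ {A B C} → A ≅U B → B ≅U C → A ≅U C
      ⇒-cong : ∀ {A A' T T'} → A ≅U A' → T ≅T T' → (A ⇒ T) ≅U (A' ⇒ T')
      Π-cong : ∀ {X A A'} → A ≅U A' → Π X A ≅U Π X A'
      α-conv : ∀ {X A} k → withName X k ∉ fvU (Π X A) →
               Π X A ≅U Π (withName X k) (A [ X ≔ varArg X k ])

    data _≅T_ : Ty → Ty → Set (c ⊔ ℓ) where
      reflT  : ∀ {T} → T ≅T T
      symT   : ∀ {T R} → T ≅T R → R ≅T T
      transT : ∀ {T R Q} → T ≅T R → R ≅T Q → T ≅T Q
      ⌜⌝-cong : ∀ {A B} → A ≅U B → ⌜ A ⌝ ≅T ⌜ B ⌝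
      ·-cong : ∀ {α β T R} → α ≈ β → T ≅T R → α · T ≅T β · R
      ⊕-cong : ∀ {T T' R R'} → T ≅T T' → R ≅T R' → T ⊕ R ≅T T' ⊕ R'
      one    : ∀ {T} → 1# · T ≅T T
      assoc· : ∀ {α β T} → α · (β · T) ≅T (α * β) · T
      distr  : ∀ {α T R} → α · T ⊕ α · R ≅T α · (T ⊕ R)
      fact   : ∀ {α β T} → α · T ⊕ β · T ≅T (α + β) · T
      comm   : ∀ {T R} → T ⊕ R ≅T R ⊕ T
      assoc⊕ : ∀ {T R Q} → T ⊕ (R ⊕ Q) ≅T (T ⊕ R) ⊕ Q

  -- Contexts: lists of declarations x : U; Γ , x : U is  (x , U) ∷ Γ,
  -- lookup returns the most recent declaration of x.

  Ctx : Set c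
  Ctx = List (ℕ × UTy)

  data _∋_⦂_ : Ctx → ℕ → UTy → Set c where
    here  : ∀ {Γ x U} → ((x , U) ∷ Γ) ∋ x ⦂ U
    there : ∀ {Γ x y U V} → x ≢ y → Γ ∋ x ⦂ U → ((y , V) ∷ Γ) ∋ x ⦂ U

  FVΓ : Ctx → List TV
  FVΓ Γ = concatMap (λ d → fvU (proj₂ d)) Γ

  infix 3 _⊢_⦂_
  data _⊢_⦂_ : Ctx → Tm → Ty → Set (c ⊔ ℓ) where
    ax   : ∀ {Γ x U} → Γ ∋ x ⦂ U → Γ ⊢ ` x ⦂ ⌜ U ⌝
    ≡-rule : ∀ {Γ t T R} → Γ ⊢ t ⦂ T → R ≅T T → Γ ⊢ t ⦂ R
    →I   : ∀ {Γ x t U T} → ((x , U) ∷ Γ) ⊢ t ⦂ T → Γ ⊢ ƛ x t ⦂ ⌜ U ⇒ T ⌝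
    →E   : ∀ {Γ t r n m} {α : Fin (suc n) → S} {β : Fin (suc m) → S}
             {Xs : List TV} {U : UTy} {T : Fin (suc n) → Ty}
             {A⃗ : Fin (suc m) → All Arg Xs} →
           Γ ⊢ t ⦂ ΣT (λ i → α i · ⌜ Πs Xs (U ⇒ T i) ⌝) →
           Γ ⊢ r ⦂ ΣT (λ j → β j · ⌜ substU (subAll Xs (A⃗ j)) U ⌝) →
           Γ ⊢ t ∙ r ⦂ ΣT (λ i → ΣT (λ j →
                         (α i * β j) · substT (subAll Xs (A⃗ j)) (T i)))
    ∀I   : ∀ {Γ t n} {α : Fin (suc n) → S} {U : Fin (suc n) → UTy} {X : TV} →
           Γ ⊢ t ⦂ ΣT (λ i → α i · ⌜ U i ⌝) → X ∉ FVΓ Γ →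
           Γ ⊢ t ⦂ ΣT (λ i → α i · ⌜ Π X (U i) ⌝)
    ∀E   : ∀ {Γ t n} {α : Fin (suc n) → S} {U : Fin (suc n) → UTy} {X : TV} →
           Γ ⊢ t ⦂ ΣT (λ i → α i · ⌜ Π X (U i) ⌝) → (A : Arg X) →
           Γ ⊢ t ⦂ ΣT (λ i → α i · ⌜ U i [ X ≔ A ] ⌝)
    +I   : ∀ {Γ t r T R} → Γ ⊢ t ⦂ T → Γ ⊢ r ⦂ R → Γ ⊢ t ⊹ r ⦂ T ⊕ R
    1E   : ∀ {Γ t T γ} → γ ≈ 1# → Γ ⊢ γ ⊛ t ⦂ T → Γ ⊢ t ⦂ T
    S-rule : ∀ {Γ t n γ} {α : Fin (suc n) → S} {T : Fin (suc n) → Ty} →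
           γ ≈ Σs α → (∀ i → Γ ⊢ t ⦂ T i) →
           Γ ⊢ γ ⊛ t ⦂ ΣT (λ i → α i · T i)

  data _≺[_,_]_ : Ty → TV → Ctx → Ty → Set (c ⊔ ℓ) where
    intro : ∀ {R T X Γ n} {α : Fin (suc n) → S} {U : Fin (suc n) → UTy} →
            X ∉ FVΓ Γ →
            R ≅T ΣT (λ i → α i · ⌜ U i ⌝) →
            T ≅T ΣT (λ i → α i · ⌜ Π X (U i) ⌝) →
            R ≺[ X , Γ ] T
    elim  : ∀ {R T X Γ n} {α : Fin (suc n) → S} {U : Fin (suc n) → UTy} →
            X ∉ FVΓ Γ → (A : Arg X) →
            R ≅T ΣT (λ i → α i · ⌜ Π X (U i) ⌝) →
            T ≅T ΣT (λ i → α i · ⌜ U i [ X ≔ A ] ⌝) →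
            R ≺[ X , Γ ] T

  Disjoint : List TV → Ctx → Set
  Disjoint 𝒱 Γ = ∀ {X} → X ∈ 𝒱 → X ∉ FVΓ Γ

  data _⪯[_,_]_ : Ty → List TV → Ctx → Ty → Set (c ⊔ ℓ) where
    step  : ∀ {R T X 𝒱 Γ} → Disjoint 𝒱 Γ → R ≺[ X , Γ ] T →
            R ⪯[ X ∷ 𝒱 , Γ ] T
    trans : ∀ {S' R T 𝒱₁ 𝒱₂ Γ} → S' ⪯[ 𝒱₁ , Γ ] R → R ⪯[ 𝒱₂ , Γ ] T →
            S' ⪯[ 𝒱₁ ++ 𝒱₂ , Γ ] T
    equiv : ∀ {R T 𝒱 Γ} → Disjoint 𝒱 Γ → R ≅T T → R ⪯[ 𝒱 , Γ ] T

-- A derivation of Γ ⊢ λx.t : T, and more generally of Γ ⊢ γ₁·(…·(γₖ·λx.t)) : T, ends with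
-- ≡, →I, ∀I, ∀E, 1E or S.  Following it, T stays ≡ to a weighted sum Σ αᵢ·Tᵢ whose weights add
-- up to γ₁⋯γₖ, every Tᵢ being reached by ⪯ from some Uᵢ → Rᵢ with Γ, x:Uᵢ ⊢ t : Rᵢ: →I gives a
-- single summand, 1E and S rescale and concatenate decompositions.  The ∀-rules act on each unit
-- type of T; since each Tᵢ is itself ≡ to a sum of unit types, the action on Tᵢ is one ≺-step, and
-- it can be pushed through ≡ because ≡ is stable under capture-avoiding substitution.  That
-- stability, including the renaming of bound variables, is where most of the work lies.

module Submission where

open import Defs
open import Level using (_⊔_)
open import Algebra.Bundles using (CommutativeRing; CommutativeMonoid)
open import Data.Nat as ℕ using (ℕ; suc; _<_)
import Data.Nat.Properties as ℕ
open import Data.Fin using (Fin; zero; suc)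
open import Data.List using (List; []; _∷_; _++_; concat; concatMap; map; length; lookup; allFin)
open import Data.List.Properties using (map-cong-local)
open import Data.List.Relation.Unary.All using (tabulate)
open import Data.List.Relation.Unary.Any using (here; there)
open import Data.List.Membership.Propositional using (_∈_; _∉_; lose)
open import Data.List.Membership.Propositional.Properties
  using (∈-++⁺ˡ; ∈-++⁺ʳ; ∈-++⁻; ∈-concatMap⁺; ∈-allFin)
open import Data.List.Relation.Unary.Any.Properties using (singleton⁻)
open import Data.List.Relation.Binary.BagAndSetEquality
  using (_∼[_]_; set; commutativeMonoid; ++-cong; ++-idempotent)
open import Data.Product using (Σ; ∃; ∃-syntax; _×_; _,_; proj₁; proj₂)
open import Data.Sum using (inj₁; inj₂)
open import Data.Unit using (⊤; tt)
open import Data.Empty using (⊥; ⊥-elim)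
open import Function.Bundles using (_⇔_; mk⇔; module Equivalence)
open Equivalence using (to; from)
open import Function.Properties.Equivalence using () renaming (refl to ⇔-refl; sym to ⇔-sym; trans to ⇔-trans)
open import Function.Base using (_∘_)
open import Relation.Nullary using (yes; no)
open import Relation.Binary.PropositionalEquality as ≡
  using (_≡_; _≢_; refl; sym; cong; cong₂; subst)

withName-withName : ∀ X a b → withName (withName X a) b ≡ withName X b
withName-withName (uv _) a b = refl
withName-withName (gv _) a b = refl

name-withName : ∀ X k → name (withName X k) ≡ k
name-withName (uv _) k = refl
name-withName (gv _) k = refl

∈-remove⁻ : ∀ {X Y Ys} → X ∈ remove Y Ys → X ∈ Ys × X ≢ Y
∈-remove⁻ {Y = Y} {Z ∷ Ys} p with Y ≟TV Z
... | yes refl = let q , X≢Y = ∈-remove⁻ {Ys = Ys} p in there q , X≢Y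
∈-remove⁻ {Y = Y} {Z ∷ Ys} (here refl) | no Y≢Z = here refl , λ X≡Y → Y≢Z (sym X≡Y)
∈-remove⁻ {Y = Y} {Z ∷ Ys} (there p)   | no _   = let q , X≢Y = ∈-remove⁻ {Ys = Ys} p in there q , X≢Y

∈-remove⁺ : ∀ {X Y Ys} → X ∈ Ys → X ≢ Y → X ∈ remove Y Ys
∈-remove⁺ {Y = Y} {Z ∷ Ys} p X≢Y with Y ≟TV Z
∈-remove⁺ (here refl) X≢Y | yes refl = ⊥-elim (X≢Y refl)
∈-remove⁺ (there p)   X≢Y | yes refl = ∈-remove⁺ p X≢Y
∈-remove⁺ (here refl) X≢Y | no _     = here refl
∈-remove⁺ (there p)   X≢Y | no _     = there (∈-remove⁺ p X≢Y)

name<freshName : ∀ {Y Ys} → Y ∈ Ys → name Y < freshName Ys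
name<freshName {Ys = Z ∷ _} (here refl) = ℕ.s≤s (ℕ.m≤m⊔n (name Z) _)
name<freshName {Ys = Z ∷ _} (there p) =
  ℕ.<-≤-trans (name<freshName p) (ℕ.s≤s (ℕ.m≤n⊔m (name Z) _))

freshName-fresh : ∀ X Ys → withName X (freshName Ys) ∉ Ys
freshName-fresh X Ys p = ℕ.<-irrefl (name-withName X (freshName Ys)) (name<freshName p)

module Substitution {c ℓ} (Ring : CommutativeRing c ℓ) where

  open Lambda Ring
  open CommutativeRing Ring using () renaming (refl to ≈-refl)

  ≅Arg : (X : TV) → Arg X → Arg X → Set (c ⊔ ℓ)
  ≅Arg (uv _) = _≅U_
  ≅Arg (gv _) = _≅T_

  syntax ≅Arg X a b = a ≅[ X ] b

  ≅Arg-refl : ∀ X {a} → a ≅[ X ] a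
  ≅Arg-refl (uv _) = reflU
  ≅Arg-refl (gv _) = reflT

  ≅Arg-reflexive : ∀ X {a b} → a ≡ b → a ≅[ X ] b
  ≅Arg-reflexive X refl = ≅Arg-refl X

  ≡⇒≅U : ∀ {A B} → A ≡ B → A ≅U B
  ≡⇒≅U refl = reflU

  ≡⇒≅T : ∀ {T R} → T ≡ R → T ≅T R
  ≡⇒≅T refl = reflT

  substArg : (X : TV) → Sub → Arg X → Arg X
  substArg (uv _) = substU
  substArg (gv _) = substT

  infixr 25 _⊙_
  _⊙_ : Sub → Sub → Sub
  (τ ⊙ σ) X = substArg X τ (σ X)

  ,,-here : ∀ σ X a → (σ ,, X ↦ a) X ≡ a
  ,,-here σ X a with X ≟TV X
  ... | yes refl = refl
  ... | no X≢X = ⊥-elim (X≢X refl)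

  ,,-there : ∀ σ X a {Y} → Y ≢ X → (σ ,, X ↦ a) Y ≡ σ Y
  ,,-there σ X a {Y} Y≢X with Y ≟TV X
  ... | yes refl = ⊥-elim (Y≢X refl)
  ... | no _ = refl

  ,,-pointwise : ∀ {p} (R : (Z : TV) → Arg Z → Arg Z → Set p) σ τ X a b →
                 R X a b → (∀ {Z} → Z ≢ X → R Z (σ Z) (τ Z)) →
                 ∀ Z → R Z ((σ ,, X ↦ a) Z) ((τ ,, X ↦ b) Z)
  ,,-pointwise R σ τ X a b Rab Rστ Z with Z ≟TV X
  ... | yes refl = Rab
  ... | no Z≢X = Rστ Z≢X

  ,,-cong : ∀ σ τ X a {Zs} → (∀ {Z} → Z ∈ remove X Zs → σ Z ≡ τ Z) →
            ∀ {Z} → Z ∈ Zs → (σ ,, X ↦ a) Z ≡ (τ ,, X ↦ a) Z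
  ,,-cong σ τ X a {Zs} σ≡τ {Z} = ,,-pointwise (λ Z u v → Z ∈ Zs → u ≡ v) σ τ X a a
                                   (λ _ → refl) (λ Z≢X z → σ≡τ (∈-remove⁺ z Z≢X)) Z

  ∈-fvArg-idSub⁻ : ∀ {X Y} → Y ∈ fvArg X (idSub X) → Y ≡ X
  ∈-fvArg-idSub⁻ {uv _} = singleton⁻
  ∈-fvArg-idSub⁻ {gv _} = singleton⁻

  ∈-fvArg-idSub⁺ : ∀ X → X ∈ fvArg X (idSub X)
  ∈-fvArg-idSub⁺ (uv _) = here refl
  ∈-fvArg-idSub⁺ (gv _) = here refl

  ∈-fvArg-varArg⁻ : ∀ {X k Y} → Y ∈ fvArg X (varArg X k) → Y ≡ withName X k
  ∈-fvArg-varArg⁻ {uv _} = singleton⁻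
  ∈-fvArg-varArg⁻ {gv _} = singleton⁻

  substArg-idSub : ∀ X ρ → substArg X ρ (idSub X) ≡ ρ X
  substArg-idSub (uv _) ρ = refl
  substArg-idSub (gv _) ρ = refl

  -- Renaming keeps the sort, so an argument for X is one for withName X k.
  recast : ∀ X k → Arg X → Arg (withName X k)
  recast (uv _) k a = a
  recast (gv _) k a = a

  substArg-varArg : ∀ X ρ k (b : Arg X) →
                    substArg X (ρ ,, withName X k ↦ recast X k b) (varArg X k) ≡ b
  substArg-varArg (uv _) ρ k b = ,,-here ρ (uv k) b
  substArg-varArg (gv _) ρ k b = ,,-here ρ (gv k) b

  substArg-varArg-renamed : ∀ X ρ k m →
    substArg X (ρ ,, withName X k ↦ varArg (withName X k) m) (varArg X k) ≡ varArg X m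
  substArg-varArg-renamed (uv _) ρ k m = ,,-here ρ (uv k) (tvar m)
  substArg-varArg-renamed (gv _) ρ k m = ,,-here ρ (gv k) (gvar m)

  α-conv-renamed : ∀ X {A} a b → withName X b ∉ fvU (Π (withName X a) A) →
    Π (withName X a) A ≅U Π (withName X b) (A [ withName X a ≔ varArg (withName X a) b ])
  α-conv-renamed (uv _) a b = α-conv b
  α-conv-renamed (gv _) a b = α-conv b

  Π-withName-withName : ∀ X a b A → Π (withName (withName X a) b) A ≅U Π (withName X b) A
  Π-withName-withName X a b A = ≡⇒≅U (cong (λ Y → Π Y A) (withName-withName X a b))

  binderName : Sub → TV → UTy → ℕ
  binderName σ X A = freshName (concatMap (λ W → fvArg W (σ W)) (fvU (Π X A)))

  FreshFor : Sub → TV → UTy → ℕ → Set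
  FreshFor σ X A k = ∀ {W} → W ∈ fvU (Π X A) → withName X k ∉ fvArg W (σ W)

  binderName-fresh : ∀ σ X A → FreshFor σ X A (binderName σ X A)
  binderName-fresh σ X A w p = freshName-fresh X _ (∈-concatMap⁺ (λ W → fvArg W (σ W)) (lose w p))

  mutual
    fvU-substU⁻ : ∀ ρ A {Y} → Y ∈ fvU (substU ρ A) → ∃ λ Z → Z ∈ fvU A × Y ∈ fvArg Z (ρ Z)
    fvU-substU⁻ ρ (tvar n) p = uv n , here refl , p
    fvU-substU⁻ ρ (A ⇒ T) p with ∈-++⁻ (fvU (substU ρ A)) p
    ... | inj₁ q = let Z , z , r = fvU-substU⁻ ρ A q in Z , ∈-++⁺ˡ z , r
    ... | inj₂ q = let Z , z , r = fvT-substT⁻ ρ T q in Z , ∈-++⁺ʳ (fvU A) z , r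
    fvU-substU⁻ ρ (Π X A) p with ∈-remove⁻ p
    ... | q , Y≢X′ with fvU-substU⁻ (ρ ,, X ↦ varArg X (binderName ρ X A)) A q
    ... | Z , z , r with Z ≟TV X
    ... | yes refl = ⊥-elim (Y≢X′ (∈-fvArg-varArg⁻ r))
    ... | no Z≢X = Z , ∈-remove⁺ z Z≢X , r

    fvT-substT⁻ : ∀ ρ T {Y} → Y ∈ fvT (substT ρ T) → ∃ λ Z → Z ∈ fvT T × Y ∈ fvArg Z (ρ Z)
    fvT-substT⁻ ρ ⌜ A ⌝ p = fvU-substU⁻ ρ A p
    fvT-substT⁻ ρ (α · T) p = fvT-substT⁻ ρ T p
    fvT-substT⁻ ρ (T ⊕ R) p with ∈-++⁻ (fvT (substT ρ T)) p
    ... | inj₁ q = let Z , z , r = fvT-substT⁻ ρ T q in Z , ∈-++⁺ˡ z , r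
    ... | inj₂ q = let Z , z , r = fvT-substT⁻ ρ R q in Z , ∈-++⁺ʳ (fvT T) z , r
    fvT-substT⁻ ρ (gvar n) p = gv n , here refl , p

  mutual
    fvU-substU⁺ : ∀ ρ A {Y Z} → Z ∈ fvU A → Y ∈ fvArg Z (ρ Z) → Y ∈ fvU (substU ρ A)
    fvU-substU⁺ ρ (tvar n) (here refl) q = q
    fvU-substU⁺ ρ (A ⇒ T) z q with ∈-++⁻ (fvU A) z
    ... | inj₁ z′ = ∈-++⁺ˡ (fvU-substU⁺ ρ A z′ q)
    ... | inj₂ z′ = ∈-++⁺ʳ (fvU (substU ρ A)) (fvT-substT⁺ ρ T z′ q)
    fvU-substU⁺ ρ (Π X A) {Y} {Z} z q with ∈-remove⁻ z
    ... | z′ , Z≢X =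
      ∈-remove⁺ (fvU-substU⁺ _ A z′ (subst (λ a → Y ∈ fvArg Z a) (sym (,,-there ρ X _ Z≢X)) q))
                (λ Y≡X′ → binderName-fresh ρ X A z (subst (λ W → W ∈ fvArg Z (ρ Z)) Y≡X′ q))

    fvT-substT⁺ : ∀ ρ T {Y Z} → Z ∈ fvT T → Y ∈ fvArg Z (ρ Z) → Y ∈ fvT (substT ρ T)
    fvT-substT⁺ ρ ⌜ A ⌝ z q = fvU-substU⁺ ρ A z q
    fvT-substT⁺ ρ (α · T) z q = fvT-substT⁺ ρ T z q
    fvT-substT⁺ ρ (T ⊕ R) z q with ∈-++⁻ (fvT T) z
    ... | inj₁ z′ = ∈-++⁺ˡ (fvT-substT⁺ ρ T z′ q)
    ... | inj₂ z′ = ∈-++⁺ʳ (fvT (substT ρ T)) (fvT-substT⁺ ρ R z′ q)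
    fvT-substT⁺ ρ (gvar n) (here refl) q = q

  fvArg-substArg⁻ : ∀ X ρ a {Y} → Y ∈ fvArg X (substArg X ρ a) →
                    ∃ λ Z → Z ∈ fvArg X a × Y ∈ fvArg Z (ρ Z)
  fvArg-substArg⁻ (uv _) ρ a = fvU-substU⁻ ρ a
  fvArg-substArg⁻ (gv _) ρ a = fvT-substT⁻ ρ a

  binderName-cong : ∀ σ τ X A → (∀ {Z} → Z ∈ fvU (Π X A) → σ Z ≡ τ Z) →
                    binderName σ X A ≡ binderName τ X A
  binderName-cong σ τ X A σ≡τ =
    cong (λ Ys → freshName (concat Ys)) (map-cong-local (tabulate (λ z → cong (fvArg _) (σ≡τ z))))

  mutual
    substU-cong : ∀ σ τ A → (∀ {Z} → Z ∈ fvU A → σ Z ≡ τ Z) → substU σ A ≡ substU τ A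
    substU-cong σ τ (tvar n) σ≡τ = σ≡τ (here refl)
    substU-cong σ τ (A ⇒ T) σ≡τ =
      cong₂ _⇒_ (substU-cong σ τ A (λ z → σ≡τ (∈-++⁺ˡ z)))
                (substT-cong σ τ T (λ z → σ≡τ (∈-++⁺ʳ (fvU A) z)))
    substU-cong σ τ (Π X A) σ≡τ =
      ≡.trans (cong (λ k → Π (withName X k) (substU (σ ,, X ↦ varArg X k) A))
                  (binderName-cong σ τ X A σ≡τ))
              (cong (Π _) (substU-cong _ _ A (,,-cong σ τ X _ σ≡τ)))

    substT-cong : ∀ σ τ T → (∀ {Z} → Z ∈ fvT T → σ Z ≡ τ Z) → substT σ T ≡ substT τ T
    substT-cong σ τ ⌜ A ⌝ σ≡τ = cong ⌜_⌝ (substU-cong σ τ A σ≡τ)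
    substT-cong σ τ (α · T) σ≡τ = cong (α ·_) (substT-cong σ τ T σ≡τ)
    substT-cong σ τ (T ⊕ R) σ≡τ =
      cong₂ _⊕_ (substT-cong σ τ T (λ z → σ≡τ (∈-++⁺ˡ z)))
                (substT-cong σ τ R (λ z → σ≡τ (∈-++⁺ʳ (fvT T) z)))
    substT-cong σ τ (gvar n) σ≡τ = σ≡τ (here refl)

  substArg-cong : ∀ X σ τ a → (∀ {Z} → Z ∈ fvArg X a → σ Z ≡ τ Z) → substArg X σ a ≡ substArg X τ a
  substArg-cong (uv _) σ τ = substU-cong σ τ
  substArg-cong (gv _) σ τ = substT-cong σ τ

  mutual
    substU-id : ∀ ρ A → (∀ {Z} → Z ∈ fvU A → ρ Z ≡ idSub Z) → substU ρ A ≅U A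
    substU-id ρ (tvar n) ρ≡id = ≡⇒≅U (ρ≡id (here refl))
    substU-id ρ (A ⇒ T) ρ≡id =
      ⇒-cong (substU-id ρ A (λ z → ρ≡id (∈-++⁺ˡ z))) (substT-id ρ T (λ z → ρ≡id (∈-++⁺ʳ (fvU A) z)))
    substU-id ρ (Π Y B) ρ≡id =
      transU (≡⇒≅U (cong (Π _) (substU-cong _ _ B (,,-cong ρ idSub Y _ ρ≡id))))
             (symU (α-conv (binderName ρ Y B) fresh))
      where
        Yk = withName Y (binderName ρ Y B)
        fresh : Yk ∉ fvU (Π Y B)
        fresh w = binderName-fresh ρ Y B w
                    (subst (λ a → Yk ∈ fvArg Yk a) (sym (ρ≡id w)) (∈-fvArg-idSub⁺ Yk))

    substT-id : ∀ ρ T → (∀ {Z} → Z ∈ fvT T → ρ Z ≡ idSub Z) → substT ρ T ≅T T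
    substT-id ρ ⌜ A ⌝ ρ≡id = ⌜⌝-cong (substU-id ρ A ρ≡id)
    substT-id ρ (α · T) ρ≡id = ·-cong ≈-refl (substT-id ρ T ρ≡id)
    substT-id ρ (T ⊕ R) ρ≡id =
      ⊕-cong (substT-id ρ T (λ z → ρ≡id (∈-++⁺ˡ z))) (substT-id ρ R (λ z → ρ≡id (∈-++⁺ʳ (fvT T) z)))
    substT-id ρ (gvar n) ρ≡id = ≡⇒≅T (ρ≡id (here refl))

  substArg-id : ∀ X ρ a → (∀ {Z} → Z ∈ fvArg X a → ρ Z ≡ idSub Z) → substArg X ρ a ≅[ X ] a
  substArg-id (uv _) = substU-id
  substArg-id (gv _) = substT-id

  open CommutativeMonoid (commutativeMonoid set TV) using ()
    renaming (refl to ∼-refl; sym to ∼-sym; trans to ∼-trans; comm to ++-comm; assoc to ++-assoc)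

  remove-cong : ∀ X {Ys Zs} → Ys ∼[ set ] Zs → remove X Ys ∼[ set ] remove X Zs
  remove-cong X Ys∼Zs = mk⇔ (keep (to Ys∼Zs)) (keep (from Ys∼Zs))
    where
      keep : ∀ {Ys Zs Y} → (Y ∈ Ys → Y ∈ Zs) → Y ∈ remove X Ys → Y ∈ remove X Zs
      keep ⊆ p = let q , Y≢X = ∈-remove⁻ p in ∈-remove⁺ (⊆ q) Y≢X

  fv-α-conv : ∀ X A k → withName X k ∉ fvU (Π X A) →
              fvU (Π X A) ∼[ set ] fvU (Π (withName X k) (A [ X ≔ varArg X k ]))
  fv-α-conv X A k fresh = mk⇔ forth back
    where
      ι = idSub ,, X ↦ varArg X k
      forth : ∀ {Y} → Y ∈ fvU (Π X A) → Y ∈ fvU (Π (withName X k) (A [ X ≔ varArg X k ]))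
      forth {Y} p with ∈-remove⁻ p
      ... | q , Y≢X =
        ∈-remove⁺ (fvU-substU⁺ ι A q (subst (λ a → Y ∈ fvArg Y a) (sym (,,-there idSub X _ Y≢X))
                                            (∈-fvArg-idSub⁺ Y)))
                  (λ Y≡Xk → fresh (subst (_∈ fvU (Π X A)) Y≡Xk p))
      back : ∀ {Y} → Y ∈ fvU (Π (withName X k) (A [ X ≔ varArg X k ])) → Y ∈ fvU (Π X A)
      back p with ∈-remove⁻ p
      ... | q , Y≢Xk with fvU-substU⁻ ι A q
      ... | Z , z , r with Z ≟TV X
      ... | yes refl = ⊥-elim (Y≢Xk (∈-fvArg-varArg⁻ r))
      ... | no Z≢X rewrite ∈-fvArg-idSub⁻ r = ∈-remove⁺ z Z≢X

  mutual
    fvU-resp : ∀ {A B} → A ≅U B → fvU A ∼[ set ] fvU B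
    fvU-resp reflU = ∼-refl
    fvU-resp (symU d) = ∼-sym (fvU-resp d)
    fvU-resp (transU d e) = ∼-trans (fvU-resp d) (fvU-resp e)
    fvU-resp (⇒-cong d e) = ++-cong (fvU-resp d) (fvT-resp e)
    fvU-resp (Π-cong {X} d) = remove-cong X (fvU-resp d)
    fvU-resp (α-conv {X} {A} k fresh) = fv-α-conv X A k fresh

    fvT-resp : ∀ {T R} → T ≅T R → fvT T ∼[ set ] fvT R
    fvT-resp reflT = ∼-refl
    fvT-resp (symT d) = ∼-sym (fvT-resp d)
    fvT-resp (transT d e) = ∼-trans (fvT-resp d) (fvT-resp e)
    fvT-resp (⌜⌝-cong d) = fvU-resp d
    fvT-resp (·-cong _ d) = fvT-resp d
    fvT-resp (⊕-cong d e) = ++-cong (fvT-resp d) (fvT-resp e)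
    fvT-resp one = ∼-refl
    fvT-resp assoc· = ∼-refl
    fvT-resp distr = ∼-refl
    fvT-resp (fact {T = T}) = ++-idempotent (fvT T)
    fvT-resp (comm {T} {R}) = ++-comm (fvT T) (fvT R)
    fvT-resp (assoc⊕ {T} {R} {Q}) = ∼-sym (++-assoc (fvT T) (fvT R) (fvT Q))

  -- Composition and congruence meet binders renamed apart, which Π-rename reconciles; Π-rename
  -- itself is an α-conversion followed by a composition.
  mutual
    Π-rename : ∀ σ X A a b → FreshFor σ X A a → FreshFor σ X A b →
      Π (withName X a) (substU (σ ,, X ↦ varArg X a) A) ≅U Π (withName X b) (substU (σ ,, X ↦ varArg X b) A)
    Π-rename σ X A a b a-fresh b-fresh =
      transU (α-conv-renamed X a b b-fresh′)
             (Π-cong (transU (substU-⊙ ι σa A) (substU-≅-cong (ι ⊙ σa) σb A agree)))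
      where
        σa = σ ,, X ↦ varArg X a
        σb = σ ,, X ↦ varArg X b
        ι = idSub ,, withName X a ↦ varArg (withName X a) b
        b-fresh′ : withName X b ∉ fvU (Π (withName X a) (substU σa A))
        b-fresh′ p with ∈-remove⁻ p
        ... | q , Xb≢Xa with fvU-substU⁻ σa A q
        ... | Z , z , r with Z ≟TV X
        ... | yes refl = Xb≢Xa (∈-fvArg-varArg⁻ r)
        ... | no Z≢X = b-fresh (∈-remove⁺ z Z≢X) r
        agree : ∀ {Z} → Z ∈ fvU A → (ι ⊙ σa) Z ≅[ Z ] σb Z
        agree {Z} = ,,-pointwise (λ Z u v → Z ∈ fvU A → substArg Z ι u ≅[ Z ] v) σ σ X _ _
          (λ _ → ≅Arg-reflexive X (substArg-varArg-renamed X idSub a b))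
          (λ {Z} Z≢X z → substArg-id Z ι (σ Z) λ v → ,,-there idSub (withName X a) _ λ V≡Xa →
             a-fresh (∈-remove⁺ z Z≢X) (subst (_∈ fvArg Z (σ Z)) V≡Xa v))
          Z

    substU-⊙ : ∀ τ σ A → substU τ (substU σ A) ≅U substU (τ ⊙ σ) A
    substU-⊙ τ σ (tvar n) = reflU
    substU-⊙ τ σ (A ⇒ T) = ⇒-cong (substU-⊙ τ σ A) (substT-⊙ τ σ T)
    substU-⊙ τ σ (Π X A) =
      transU (Π-withName-withName X k₁ k₂ _)
      (transU (Π-cong (transU (substU-⊙ τ₁ σ₁ A) (substU-≅-cong (τ₁ ⊙ σ₁) _ A agree)))
              (Π-rename ρ X A k₂ (binderName ρ X A) k₂-fresh (binderName-fresh ρ X A)))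
      where
        k₁ = binderName σ X A
        σ₁ = σ ,, X ↦ varArg X k₁
        k₂ = binderName τ (withName X k₁) (substU σ₁ A)
        τ₁ = τ ,, withName X k₁ ↦ varArg (withName X k₁) k₂
        ρ = τ ⊙ σ
        agree : ∀ {Z} → Z ∈ fvU A → (τ₁ ⊙ σ₁) Z ≅[ Z ] (ρ ,, X ↦ varArg X k₂) Z
        agree {Z} = ,,-pointwise (λ Z u v → Z ∈ fvU A → substArg Z τ₁ u ≅[ Z ] v) σ ρ X _ _
          (λ _ → ≅Arg-reflexive X (substArg-varArg-renamed X τ k₁ k₂))
          (λ {Z} Z≢X z → ≅Arg-reflexive Z (substArg-cong Z τ₁ τ (σ Z) λ v →
             ,,-there τ (withName X k₁) _ λ V≡Xk₁ →
               binderName-fresh σ X A (∈-remove⁺ z Z≢X) (subst (_∈ fvArg Z (σ Z)) V≡Xk₁ v)))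
          Z
        k₂-fresh : FreshFor ρ X A k₂
        k₂-fresh {W} w p with fvArg-substArg⁻ W τ (σ W) p | ∈-remove⁻ w
        ... | V , v , q | w′ , W≢X =
          binderName-fresh τ (withName X k₁) (substU σ₁ A)
            (∈-remove⁺ (fvU-substU⁺ σ₁ A w′ (subst (λ a → V ∈ fvArg W a) (sym (,,-there σ X _ W≢X)) v))
                       (λ V≡Xk₁ → binderName-fresh σ X A w (subst (_∈ fvArg W (σ W)) V≡Xk₁ v)))
            (subst (_∈ fvArg V (τ V)) (sym (withName-withName X k₁ k₂)) q)

    substT-⊙ : ∀ τ σ T → substT τ (substT σ T) ≅T substT (τ ⊙ σ) T
    substT-⊙ τ σ ⌜ A ⌝ = ⌜⌝-cong (substU-⊙ τ σ A)
    substT-⊙ τ σ (α · T) = ·-cong ≈-refl (substT-⊙ τ σ T)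
    substT-⊙ τ σ (T ⊕ R) = ⊕-cong (substT-⊙ τ σ T) (substT-⊙ τ σ R)
    substT-⊙ τ σ (gvar n) = reflT

    substU-≅-cong : ∀ σ τ A → (∀ {Z} → Z ∈ fvU A → σ Z ≅[ Z ] τ Z) → substU σ A ≅U substU τ A
    substU-≅-cong σ τ (tvar n) σ≅τ = σ≅τ (here refl)
    substU-≅-cong σ τ (A ⇒ T) σ≅τ =
      ⇒-cong (substU-≅-cong σ τ A (λ z → σ≅τ (∈-++⁺ˡ z)))
             (substT-≅-cong σ τ T (λ z → σ≅τ (∈-++⁺ʳ (fvU A) z)))
    substU-≅-cong σ τ (Π X A) σ≅τ =
      transU (Π-rename σ X A (binderName σ X A) k (binderName-fresh σ X A) k-fresh-σ)
      (transU (Π-cong (substU-≅-cong (σ ,, X ↦ varArg X k) (τ ,, X ↦ varArg X k) A agree))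
              (symU (Π-rename τ X A (binderName τ X A) k (binderName-fresh τ X A) k-fresh-τ)))
      where
        fvσ = concatMap (λ W → fvArg W (σ W)) (fvU (Π X A))
        fvτ = concatMap (λ W → fvArg W (τ W)) (fvU (Π X A))
        k = freshName (fvσ ++ fvτ)
        k-fresh-σ : FreshFor σ X A k
        k-fresh-σ w p = freshName-fresh X (fvσ ++ fvτ)
                          (∈-++⁺ˡ (∈-concatMap⁺ (λ W → fvArg W (σ W)) (lose w p)))
        k-fresh-τ : FreshFor τ X A k
        k-fresh-τ w p = freshName-fresh X (fvσ ++ fvτ)
                          (∈-++⁺ʳ fvσ (∈-concatMap⁺ (λ W → fvArg W (τ W)) (lose w p)))
        agree : ∀ {Z} → Z ∈ fvU A → (σ ,, X ↦ varArg X k) Z ≅[ Z ] (τ ,, X ↦ varArg X k) Z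
        agree {Z} = ,,-pointwise (λ Z u v → Z ∈ fvU A → u ≅[ Z ] v) σ τ X _ _
          (λ _ → ≅Arg-refl X) (λ Z≢X z → σ≅τ (∈-remove⁺ z Z≢X)) Z

    substT-≅-cong : ∀ σ τ T → (∀ {Z} → Z ∈ fvT T → σ Z ≅[ Z ] τ Z) → substT σ T ≅T substT τ T
    substT-≅-cong σ τ ⌜ A ⌝ σ≅τ = ⌜⌝-cong (substU-≅-cong σ τ A σ≅τ)
    substT-≅-cong σ τ (α · T) σ≅τ = ·-cong ≈-refl (substT-≅-cong σ τ T σ≅τ)
    substT-≅-cong σ τ (T ⊕ R) σ≅τ =
      ⊕-cong (substT-≅-cong σ τ T (λ z → σ≅τ (∈-++⁺ˡ z)))
             (substT-≅-cong σ τ R (λ z → σ≅τ (∈-++⁺ʳ (fvT T) z)))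
    substT-≅-cong σ τ (gvar n) σ≅τ = σ≅τ (here refl)

  mutual
    substU-resp : ∀ σ {A B} → A ≅U B → substU σ A ≅U substU σ B
    substU-resp σ reflU = reflU
    substU-resp σ (symU d) = symU (substU-resp σ d)
    substU-resp σ (transU d e) = transU (substU-resp σ d) (substU-resp σ e)
    substU-resp σ (⇒-cong d e) = ⇒-cong (substU-resp σ d) (substT-resp σ e)
    substU-resp σ (Π-cong {X} {A} {A′} d) =
      transU (Π-cong (substU-resp _ d))
             (Π-rename σ X A′ (binderName σ X A) (binderName σ X A′)
                       (λ w → binderName-fresh σ X A (from (fvU-resp (Π-cong {X = X} d)) w))
                       (binderName-fresh σ X A′))
    substU-resp σ (α-conv {X} {A} k fresh) =
      transU (Π-rename σ X A (binderName σ X A) k₂ (binderName-fresh σ X A) k₂-fresh)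
             (symU (transU (Π-withName-withName X k k₂ _)
                   (Π-cong (transU (substU-⊙ σ₂ ι A) (substU-≅-cong (σ₂ ⊙ ι) _ A agree)))))
      where
        ι = idSub ,, X ↦ varArg X k
        Xk = withName X k
        k₂ = binderName σ Xk (substU ι A)
        σ₂ = σ ,, Xk ↦ varArg Xk k₂
        k₂-fresh : FreshFor σ X A k₂
        k₂-fresh {W} w p = binderName-fresh σ Xk (substU ι A) (to (fv-α-conv X A k fresh) w)
                             (subst (_∈ fvArg W (σ W)) (sym (withName-withName X k k₂)) p)
        agree : ∀ {Z} → Z ∈ fvU A → (σ₂ ⊙ ι) Z ≅[ Z ] (σ ,, X ↦ varArg X k₂) Z
        agree {Z} = ,,-pointwise (λ Z u v → Z ∈ fvU A → substArg Z σ₂ u ≅[ Z ] v) idSub σ X _ _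
          (λ _ → ≅Arg-reflexive X (substArg-varArg-renamed X σ k k₂))
          (λ {Z} Z≢X z → ≅Arg-reflexive Z (≡.trans (substArg-idSub Z σ₂) (,,-there σ Xk _ λ Z≡Xk →
             fresh (subst (_∈ fvU (Π X A)) Z≡Xk (∈-remove⁺ z Z≢X)))))
          Z

    substT-resp : ∀ σ {T R} → T ≅T R → substT σ T ≅T substT σ R
    substT-resp σ reflT = reflT
    substT-resp σ (symT d) = symT (substT-resp σ d)
    substT-resp σ (transT d e) = transT (substT-resp σ d) (substT-resp σ e)
    substT-resp σ (⌜⌝-cong d) = ⌜⌝-cong (substU-resp σ d)
    substT-resp σ (·-cong α≈β d) = ·-cong α≈β (substT-resp σ d)
    substT-resp σ (⊕-cong d e) = ⊕-cong (substT-resp σ d) (substT-resp σ e)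
    substT-resp σ one = one
    substT-resp σ assoc· = assoc·
    substT-resp σ distr = distr
    substT-resp σ fact = fact
    substT-resp σ comm = comm
    substT-resp σ assoc⊕ = assoc⊕

  []-renamed : ∀ Y k (b : Arg Y) W → withName Y k ∉ fvU (Π Y W) →
               W [ Y ≔ b ] ≅U (W [ Y ≔ varArg Y k ]) [ withName Y k ≔ recast Y k b ]
  []-renamed Y k b W fresh =
    symU (transU (substU-⊙ ρ ι W) (substU-≅-cong (ρ ⊙ ι) (idSub ,, Y ↦ b) W agree))
    where
      ι = idSub ,, Y ↦ varArg Y k
      ρ = idSub ,, withName Y k ↦ recast Y k b
      agree : ∀ {Z} → Z ∈ fvU W → (ρ ⊙ ι) Z ≅[ Z ] (idSub ,, Y ↦ b) Z
      agree {Z} = ,,-pointwise (λ Z u v → Z ∈ fvU W → substArg Z ρ u ≅[ Z ] v) idSub idSub Y _ _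
        (λ _ → ≅Arg-reflexive Y (substArg-varArg Y idSub k b))
        (λ {Z} Z≢Y z → ≅Arg-reflexive Z (≡.trans (substArg-idSub Z ρ)
           (,,-there idSub (withName Y k) _ λ Z≡Yk → fresh (subst (_∈ fvU (Π Y W)) Z≡Yk (∈-remove⁺ z Z≢Y)))))
        Z

module Instantiation {c ℓ} (Ring : CommutativeRing c ℓ) where

  open Lambda Ring
  open Substitution Ring
  open CommutativeRing Ring using () renaming (refl to ≈-refl)

  instantiateΠ : (X : TV) → Arg X → TV → UTy → UTy
  instantiateΠ (uv _) A (uv n) B = B [ uv n ≔ A ]
  instantiateΠ (gv _) A (gv n) B = B [ gv n ≔ A ]
  instantiateΠ _      _ Y      B = Π Y B

  instantiate : (X : TV) → Arg X → UTy → UTy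
  instantiate X A (Π Y B) = instantiateΠ X A Y B
  instantiate X A V = V

  instantiate-Π : ∀ X A B → instantiate X A (Π X B) ≡ B [ X ≔ A ]
  instantiate-Π (uv _) A B = refl
  instantiate-Π (gv _) A B = refl

  instantiateΠ-cong : ∀ X A Y {B B′} → B ≅U B′ → instantiateΠ X A Y B ≅U instantiateΠ X A Y B′
  instantiateΠ-cong (uv _) A (uv n) d = substU-resp _ d
  instantiateΠ-cong (uv _) A (gv n) d = Π-cong d
  instantiateΠ-cong (gv _) A (uv n) d = Π-cong d
  instantiateΠ-cong (gv _) A (gv n) d = substU-resp _ d

  instantiateΠ-α-conv : ∀ X A Y B k → withName Y k ∉ fvU (Π Y B) →
    instantiateΠ X A Y B ≅U instantiateΠ X A (withName Y k) (B [ Y ≔ varArg Y k ])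
  instantiateΠ-α-conv (uv _) A (uv n) B k fresh = []-renamed (uv n) k A B fresh
  instantiateΠ-α-conv (uv _) A (gv n) B k fresh = α-conv k fresh
  instantiateΠ-α-conv (gv _) A (uv n) B k fresh = α-conv k fresh
  instantiateΠ-α-conv (gv _) A (gv n) B k fresh = []-renamed (gv n) k A B fresh

  instantiate-resp : ∀ X A {V V′} → V ≅U V′ → instantiate X A V ≅U instantiate X A V′
  instantiate-resp X A reflU = reflU
  instantiate-resp X A (symU d) = symU (instantiate-resp X A d)
  instantiate-resp X A (transU d e) = transU (instantiate-resp X A d) (instantiate-resp X A e)
  instantiate-resp X A (⇒-cong d e) = ⇒-cong d e
  instantiate-resp X A (Π-cong {Y} d) = instantiateΠ-cong X A Y d
  instantiate-resp X A (α-conv {Y} {B} k fresh) = instantiateΠ-α-conv X A Y B k fresh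

  SameSort : TV → TV → Set
  SameSort (uv _) (uv _) = ⊤
  SameSort (gv _) (gv _) = ⊤
  SameSort _      _      = ⊥

  SameSort-withName : ∀ X Y k → SameSort X Y ⇔ SameSort X (withName Y k)
  SameSort-withName (uv _) (uv _) k = ⇔-refl
  SameSort-withName (uv _) (gv _) k = ⇔-refl
  SameSort-withName (gv _) (uv _) k = ⇔-refl
  SameSort-withName (gv _) (gv _) k = ⇔-refl

  IsΠOfSort : TV → UTy → Set
  IsΠOfSort X (Π Y _) = SameSort X Y
  IsΠOfSort X _       = ⊥

  IsΠOfSort-Π : ∀ X B → IsΠOfSort X (Π X B)
  IsΠOfSort-Π (uv _) B = tt
  IsΠOfSort-Π (gv _) B = tt

  IsΠOfSort-resp : ∀ X {V V′} → V ≅U V′ → IsΠOfSort X V ⇔ IsΠOfSort X V′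
  IsΠOfSort-resp X reflU = ⇔-refl
  IsΠOfSort-resp X (symU d) = ⇔-sym (IsΠOfSort-resp X d)
  IsΠOfSort-resp X (transU d e) = ⇔-trans (IsΠOfSort-resp X d) (IsΠOfSort-resp X e)
  IsΠOfSort-resp X (⇒-cong d e) = ⇔-refl
  IsΠOfSort-resp X (Π-cong d) = ⇔-refl
  IsΠOfSort-resp X (α-conv {Y} k fresh) = SameSort-withName X Y k

  -- The rule elim of ≺ needs one bound variable shared by all summands, hence the common fresh name.
  instantiate-renamed : ∀ X A k V → IsΠOfSort X V → withName X k ∉ fvU V →
    Σ UTy λ W → (V ≅U Π (withName X k) W) × (instantiate X A V ≅U W [ withName X k ≔ recast X k A ])
  instantiate-renamed (uv _) A k (Π (uv n) B) _ fresh =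
    B [ uv n ≔ tvar k ] , α-conv k fresh , []-renamed (uv n) k A B fresh
  instantiate-renamed (gv _) A k (Π (gv n) B) _ fresh =
    B [ gv n ≔ gvar k ] , α-conv k fresh , []-renamed (gv n) k A B fresh

  mapUnits : (UTy → UTy) → Ty → Ty
  mapUnits f ⌜ V ⌝ = ⌜ f V ⌝
  mapUnits f (α · T) = α · mapUnits f T
  mapUnits f (T ⊕ R) = mapUnits f T ⊕ mapUnits f R
  mapUnits f (gvar n) = gvar n

  mapUnits-resp : ∀ {f} → (∀ {V V′} → V ≅U V′ → f V ≅U f V′) →
                  ∀ {T R} → T ≅T R → mapUnits f T ≅T mapUnits f R
  mapUnits-resp f-resp reflT = reflT
  mapUnits-resp f-resp (symT d) = symT (mapUnits-resp f-resp d)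
  mapUnits-resp f-resp (transT d e) = transT (mapUnits-resp f-resp d) (mapUnits-resp f-resp e)
  mapUnits-resp f-resp (⌜⌝-cong d) = ⌜⌝-cong (f-resp d)
  mapUnits-resp f-resp (·-cong α≈β d) = ·-cong α≈β (mapUnits-resp f-resp d)
  mapUnits-resp f-resp (⊕-cong d e) = ⊕-cong (mapUnits-resp f-resp d) (mapUnits-resp f-resp e)
  mapUnits-resp f-resp one = one
  mapUnits-resp f-resp assoc· = assoc·
  mapUnits-resp f-resp distr = distr
  mapUnits-resp f-resp fact = fact
  mapUnits-resp f-resp comm = comm
  mapUnits-resp f-resp assoc⊕ = assoc⊕

  mapUnits-ΣT : ∀ f {n} (α : Fin (suc n) → S) (U : Fin (suc n) → UTy) →
                mapUnits f (ΣT (λ i → α i · ⌜ U i ⌝)) ≡ ΣT (λ i → α i · ⌜ f (U i) ⌝)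
  mapUnits-ΣT f {ℕ.zero} α U = refl
  mapUnits-ΣT f {suc n} α U = cong (_ ⊕_) (mapUnits-ΣT f (λ i → α (suc i)) (λ i → U (suc i)))

  ΣT-cong : ∀ {n} {T R : Fin (suc n) → Ty} → (∀ i → T i ≅T R i) → ΣT T ≅T ΣT R
  ΣT-cong {ℕ.zero} T≅R = T≅R zero
  ΣT-cong {suc n} T≅R = ⊕-cong (T≅R zero) (ΣT-cong (λ i → T≅R (suc i)))

  data AllUnits {p} (P : UTy → Set p) : Ty → Set (c ⊔ p) where
    unit   : ∀ {V} → P V → AllUnits P ⌜ V ⌝
    scaled : ∀ {α T} → AllUnits P T → AllUnits P (α · T)
    sum    : ∀ {T R} → AllUnits P T → AllUnits P R → AllUnits P (T ⊕ R)

  module _ {p} {P : UTy → Set p} where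

    AllUnits-resp : (∀ {V V′} → V ≅U V′ → P V ⇔ P V′) → ∀ {T R} → T ≅T R → AllUnits P T ⇔ AllUnits P R
    AllUnits-resp P-resp reflT = ⇔-refl
    AllUnits-resp P-resp (symT d) = ⇔-sym (AllUnits-resp P-resp d)
    AllUnits-resp P-resp (transT d e) = ⇔-trans (AllUnits-resp P-resp d) (AllUnits-resp P-resp e)
    AllUnits-resp P-resp (⌜⌝-cong d) =
      mk⇔ (λ { (unit p) → unit (to (P-resp d) p) })
          (λ { (unit p) → unit (from (P-resp d) p) })
    AllUnits-resp P-resp (·-cong _ d) =
      mk⇔ (λ { (scaled p) → scaled (to (AllUnits-resp P-resp d) p) })
          (λ { (scaled p) → scaled (from (AllUnits-resp P-resp d) p) })
    AllUnits-resp P-resp (⊕-cong d e) =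
      mk⇔ (λ { (sum p q) → sum (to (AllUnits-resp P-resp d) p) (to (AllUnits-resp P-resp e) q) })
          (λ { (sum p q) → sum (from (AllUnits-resp P-resp d) p) (from (AllUnits-resp P-resp e) q) })
    AllUnits-resp P-resp one = mk⇔ (λ { (scaled p) → p }) scaled
    AllUnits-resp P-resp assoc· =
      mk⇔ (λ { (scaled (scaled p)) → scaled p }) (λ { (scaled p) → scaled (scaled p) })
    AllUnits-resp P-resp distr =
      mk⇔ (λ { (sum (scaled p) (scaled q)) → scaled (sum p q) })
          (λ { (scaled (sum p q)) → sum (scaled p) (scaled q) })
    AllUnits-resp P-resp fact =
      mk⇔ (λ { (sum (scaled p) _) → scaled p }) (λ { (scaled p) → sum (scaled p) (scaled p) })
    AllUnits-resp P-resp comm = mk⇔ (λ { (sum p q) → sum q p }) (λ { (sum p q) → sum q p })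
    AllUnits-resp P-resp assoc⊕ =
      mk⇔ (λ { (sum p (sum q r)) → sum (sum p q) r }) (λ { (sum (sum p q) r) → sum p (sum q r) })

    AllUnits-ΣT⁺ : ∀ {n} (α : Fin (suc n) → S) (U : Fin (suc n) → UTy) →
                   (∀ i → P (U i)) → AllUnits P (ΣT (λ i → α i · ⌜ U i ⌝))
    AllUnits-ΣT⁺ {ℕ.zero} α U PU = scaled (unit (PU zero))
    AllUnits-ΣT⁺ {suc n} α U PU =
      sum (scaled (unit (PU zero))) (AllUnits-ΣT⁺ (λ i → α (suc i)) (λ i → U (suc i)) (λ i → PU (suc i)))

    AllUnits-ΣT⁻ : ∀ {n} (α : Fin (suc n) → S) (U : Fin (suc n) → UTy) →
                   AllUnits P (ΣT (λ i → α i · ⌜ U i ⌝)) → ∀ i → P (U i)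
    AllUnits-ΣT⁻ {ℕ.zero} α U (scaled (unit p)) zero = p
    AllUnits-ΣT⁻ {suc n} α U (sum (scaled (unit p)) _) zero = p
    AllUnits-ΣT⁻ {suc n} α U (sum _ ps) (suc i) = AllUnits-ΣT⁻ (λ i → α (suc i)) (λ i → U (suc i)) ps i

  UnitSum : Ty → Set (c ⊔ ℓ)
  UnitSum T = Σ ℕ λ n → Σ (Fin (suc n) → S) λ β → Σ (Fin (suc n) → UTy) λ W →
                T ≅T ΣT (λ i → β i · ⌜ W i ⌝)

  UnitSum-⪯ : ∀ {Γ R T 𝒱} → R ⪯[ 𝒱 , Γ ] T → UnitSum R → UnitSum T
  UnitSum-⪯ (step _ (intro {α = α} {U = U} _ _ T≅)) _ = _ , α , (λ i → Π _ (U i)) , T≅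
  UnitSum-⪯ (step _ (elim {α = α} {U = U} _ A _ T≅)) _ = _ , α , (λ i → U i [ _ ≔ A ]) , T≅
  UnitSum-⪯ (trans R⪯ ⪯T) R-sum = UnitSum-⪯ ⪯T (UnitSum-⪯ R⪯ R-sum)
  UnitSum-⪯ (equiv _ R≅T) (n , β , W , R≅) = n , β , W , transT (symT R≅T) R≅

  ⪯-Π : ∀ {Γ T} X → X ∉ FVΓ Γ → UnitSum T → T ⪯[ X ∷ [] , Γ ] mapUnits (Π X) T
  ⪯-Π X X∉Γ (n , β , W , T≅) =
    step (λ ()) (intro {α = β} {U = W} X∉Γ T≅
                   (transT (mapUnits-resp Π-cong T≅) (≡⇒≅T (mapUnits-ΣT (Π X) β W))))

  ⪯-instantiate : ∀ {Γ T} X A → AllUnits (IsΠOfSort X) T → UnitSum T →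
                  Σ (List TV) λ 𝒱 → T ⪯[ 𝒱 , Γ ] mapUnits (instantiate X A) T
  ⪯-instantiate {Γ} X A T-Π (n , β , W , T≅) =
    Y ∷ [] , step (λ ()) (elim {α = β} {U = λ i → proj₁ (renamed i)} Y∉Γ (recast X k A)
               (transT T≅ (ΣT-cong λ i → ·-cong ≈-refl (⌜⌝-cong (proj₁ (proj₂ (renamed i))))))
               (transT (mapUnits-resp (instantiate-resp X A) T≅)
               (transT (≡⇒≅T (mapUnits-ΣT (instantiate X A) β W))
                       (ΣT-cong λ i → ·-cong ≈-refl (⌜⌝-cong (proj₂ (proj₂ (renamed i))))))))
    where
      fvW = concatMap (λ i → fvU (W i)) (allFin (suc n))
      k = freshName (FVΓ Γ ++ fvW)
      Y = withName X k
      Y∉Γ : Y ∉ FVΓ Γ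
      Y∉Γ p = freshName-fresh X (FVΓ Γ ++ fvW) (∈-++⁺ˡ p)
      W-Π : ∀ i → IsΠOfSort X (W i)
      W-Π = AllUnits-ΣT⁻ β W (to (AllUnits-resp (IsΠOfSort-resp X) T≅) T-Π)
      renamed : ∀ i → Σ UTy λ W′ → (W i ≅U Π Y W′) × (instantiate X A (W i) ≅U W′ [ Y ≔ recast X k A ])
      renamed i = instantiate-renamed X A k (W i) (W-Π i) λ p →
        freshName-fresh X (FVΓ Γ ++ fvW)
          (∈-++⁺ʳ (FVΓ Γ) (∈-concatMap⁺ (λ i → fvU (W i)) (lose (∈-allFin i) p)))

module Generation {c ℓ} (Ring : CommutativeRing c ℓ)
                  (Γ : Lambda.Ctx Ring) (x : ℕ) (t : Lambda.Tm Ring) where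

  open Lambda Ring
  open Substitution Ring using (≡⇒≅U; ≡⇒≅T)
  open Instantiation Ring
  open CommutativeRing Ring using (+-cong; *-cong; +-assoc; *-identityˡ; distribˡ; distribʳ)
    renaming (refl to ≈-refl; sym to ≈-sym; trans to ≈-trans)

  record Summand : Set (c ⊔ ℓ) where
    field
      weight : S
      type   : Ty
      dom    : UTy
      cod    : Ty
      vars   : List TV
      body   : (x , dom) ∷ Γ ⊢ t ⦂ cod
      order  : ⌜ dom ⇒ cod ⌝ ⪯[ vars , Γ ] type

  open Summand public

  weightedSum : Summand → List Summand → Ty
  weightedSum s []        = weight s · type s
  weightedSum s (s′ ∷ ss) = weight s · type s ⊕ weightedSum s′ ss

  totalWeight : Summand → List Summand → S
  totalWeight s []        = weight s
  totalWeight s (s′ ∷ ss) = weight s + totalWeight s′ ss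

  Decomposition : S → Ty → Set (c ⊔ ℓ)
  Decomposition p T = Σ Summand λ s → Σ (List Summand) λ ss →
                      (T ≅T weightedSum s ss) × (totalWeight s ss ≈ p)

  decomposition-≈ : ∀ {p q T} → p ≈ q → Decomposition p T → Decomposition q T
  decomposition-≈ p≈q (s , ss , T≅ , total≈) = s , ss , T≅ , ≈-trans total≈ p≈q

  decomposition-≅ : ∀ {p T R} → R ≅T T → Decomposition p T → Decomposition p R
  decomposition-≅ R≅T (s , ss , T≅ , total≈) = s , ss , transT R≅T T≅ , total≈

  scaleSummand : S → Summand → Summand
  scaleSummand γ s = record s { weight = γ * weight s }

  weightedSum-scale : ∀ γ s ss → γ · weightedSum s ss ≅T weightedSum (scaleSummand γ s) (map (scaleSummand γ) ss)
  weightedSum-scale γ s [] = assoc·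
  weightedSum-scale γ s (s′ ∷ ss) = transT (symT distr) (⊕-cong assoc· (weightedSum-scale γ s′ ss))

  totalWeight-scale : ∀ γ s ss → totalWeight (scaleSummand γ s) (map (scaleSummand γ) ss) ≈ γ * totalWeight s ss
  totalWeight-scale γ s [] = ≈-refl
  totalWeight-scale γ s (s′ ∷ ss) =
    ≈-trans (+-cong ≈-refl (totalWeight-scale γ s′ ss)) (≈-sym (distribˡ γ (weight s) (totalWeight s′ ss)))

  decomposition-· : ∀ γ {p T} → Decomposition p T → Decomposition (γ * p) (γ · T)
  decomposition-· γ (s , ss , T≅ , total≈) =
    scaleSummand γ s , map (scaleSummand γ) ss ,
    transT (·-cong ≈-refl T≅) (weightedSum-scale γ s ss) ,
    ≈-trans (totalWeight-scale γ s ss) (*-cong ≈-refl total≈)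

  weightedSum-++ : ∀ s ss s′ ss′ → weightedSum s ss ⊕ weightedSum s′ ss′ ≅T weightedSum s (ss ++ s′ ∷ ss′)
  weightedSum-++ s [] s′ ss′ = reflT
  weightedSum-++ s (s″ ∷ ss) s′ ss′ = transT (symT assoc⊕) (⊕-cong reflT (weightedSum-++ s″ ss s′ ss′))

  totalWeight-++ : ∀ s ss s′ ss′ → totalWeight s (ss ++ s′ ∷ ss′) ≈ totalWeight s ss + totalWeight s′ ss′
  totalWeight-++ s [] s′ ss′ = ≈-refl
  totalWeight-++ s (s″ ∷ ss) s′ ss′ =
    ≈-trans (+-cong ≈-refl (totalWeight-++ s″ ss s′ ss′)) (≈-sym (+-assoc _ _ _))

  decomposition-⊕ : ∀ {p q T R} → Decomposition p T → Decomposition q R → Decomposition (p + q) (T ⊕ R)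
  decomposition-⊕ (s , ss , T≅ , p≈) (s′ , ss′ , R≅ , q≈) =
    s , ss ++ s′ ∷ ss′ , transT (⊕-cong T≅ R≅) (weightedSum-++ s ss s′ ss′) ,
    ≈-trans (totalWeight-++ s ss s′ ss′) (+-cong p≈ q≈)

  decomposition-ΣT : ∀ {p n} (α : Fin (suc n) → S) (T : Fin (suc n) → Ty) →
                     (∀ i → Decomposition p (T i)) → Decomposition (Σs α * p) (ΣT (λ i → α i · T i))
  decomposition-ΣT {n = ℕ.zero} α T dec = decomposition-· (α zero) (dec zero)
  decomposition-ΣT {p} {suc n} α T dec =
    decomposition-≈ (≈-sym (distribʳ p (α zero) (Σs (λ i → α (suc i)))))
      (decomposition-⊕ (decomposition-· (α zero) (dec zero))
                       (decomposition-ΣT (λ i → α (suc i)) (λ i → T (suc i)) (λ i → dec (suc i))))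

  UnitSum-type : ∀ s → UnitSum (type s)
  UnitSum-type s = UnitSum-⪯ (order s) (ℕ.zero , (λ _ → 1#) , (λ _ → dom s ⇒ cod s) , symT one)

  module _ {p} {P : UTy → Set p} {f : UTy → UTy}
           (step : ∀ {T} → AllUnits P T → UnitSum T → Σ (List TV) λ 𝒱 → T ⪯[ 𝒱 , Γ ] mapUnits f T) where

    advance : (s : Summand) → AllUnits P (type s) → Summand
    advance s P-s = let 𝒱 , ⪯f = step P-s (UnitSum-type s) in
      record s { type = mapUnits f (type s) ; vars = vars s ++ 𝒱 ; order = trans (order s) ⪯f }

    advanceAll : ∀ s ss → AllUnits P (weightedSum s ss) → Σ Summand λ s′ → Σ (List Summand) λ ss′ →
                 (mapUnits f (weightedSum s ss) ≡ weightedSum s′ ss′) × (totalWeight s′ ss′ ≡ totalWeight s ss)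
    advanceAll s [] (scaled P-s) = advance s P-s , [] , refl , refl
    advanceAll s (s′ ∷ ss) (sum (scaled P-s) P-ss) =
      let s″ , ss″ , ≡sum , ≡total = advanceAll s′ ss P-ss in
      advance s P-s , s″ ∷ ss″ , cong (_ ⊕_) ≡sum , cong (_ +_) ≡total

    decomposition-mapUnits : (∀ {V V′} → V ≅U V′ → f V ≅U f V′) → (∀ {V V′} → V ≅U V′ → P V ⇔ P V′) →
                             ∀ {q T} → AllUnits P T → Decomposition q T → Decomposition q (mapUnits f T)
    decomposition-mapUnits f-resp P-resp P-T (s , ss , T≅ , total≈) =
      let s′ , ss′ , ≡sum , ≡total = advanceAll s ss (to (AllUnits-resp P-resp T≅) P-T) in
      s′ , ss′ , transT (mapUnits-resp f-resp T≅) (≡⇒≅T ≡sum) , subst (_≈ _) (sym ≡total) total≈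

  data ScaledAbstraction : Tm → S → Set c where
    abs   : ScaledAbstraction (ƛ x t) 1#
    scale : ∀ {s p} γ → ScaledAbstraction s p → ScaledAbstraction (γ ⊛ s) (γ * p)

  -- Generalised over scalar multiples of the abstraction, so that the rules 1E and S can be traversed.
  generation : ∀ {s T p} → Γ ⊢ s ⦂ T → ScaledAbstraction s p → Decomposition p T
  generation (ax _) ()
  generation (→E _ _) ()
  generation (+I _ _) ()
  generation (≡-rule D R≅T) w = decomposition-≅ R≅T (generation D w)
  generation (→I {U = U} {T = R} D) abs =
    record { weight = 1# ; type = ⌜ U ⇒ R ⌝ ; dom = U ; cod = R ; vars = []
           ; body = D ; order = equiv (λ ()) reflT } ,
    [] , symT one , ≈-refl
  generation (∀I {α = α} {U = U} {X = X} D X∉Γ) w =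
    subst (Decomposition _) (mapUnits-ΣT (Π X) α U)
      (decomposition-mapUnits {P = λ _ → ⊤} (λ _ T-sum → X ∷ [] , ⪯-Π X X∉Γ T-sum) Π-cong (λ _ → ⇔-refl)
                              (AllUnits-ΣT⁺ α U (λ _ → tt)) (generation D w))
  generation (∀E {α = α} {U = U} {X = X} D A) w =
    decomposition-≅ (transT (ΣT-cong λ i → ·-cong ≈-refl (⌜⌝-cong (≡⇒≅U (sym (instantiate-Π X A (U i))))))
                            (≡⇒≅T (sym (mapUnits-ΣT (instantiate X A) α (λ i → Π X (U i))))))
      (decomposition-mapUnits (⪯-instantiate X A) (instantiate-resp X A) (IsΠOfSort-resp X)
                              (AllUnits-ΣT⁺ α _ (λ i → IsΠOfSort-Π X (U i))) (generation D w))
  generation (1E γ≈1 D) w =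
    decomposition-≈ (≈-trans (*-cong γ≈1 ≈-refl) (*-identityˡ _)) (generation D (scale _ w))
  generation (S-rule {α = α} {T = T} γ≈Σα Ds) (scale γ w) =
    decomposition-≈ (*-cong (≈-sym γ≈Σα) ≈-refl) (decomposition-ΣT α T (λ i → generation (Ds i) w))

  ΣT-lookup : ∀ s ss → ΣT (λ i → weight (lookup (s ∷ ss) i) · type (lookup (s ∷ ss) i)) ≡ weightedSum s ss
  ΣT-lookup s [] = refl
  ΣT-lookup s (s′ ∷ ss) = cong (_ ⊕_) (ΣT-lookup s′ ss)

  Σs-lookup : ∀ s ss → Σs (λ i → weight (lookup (s ∷ ss) i)) ≡ totalWeight s ss
  Σs-lookup s [] = refl
  Σs-lookup s (s′ ∷ ss) = cong (_ +_) (Σs-lookup s′ ss)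

  abstraction-decomposition : ∀ {T} → Γ ⊢ ƛ x t ⦂ T →
    Σ ℕ λ n → Σ (Fin (suc n) → Summand) λ ss →
      (T ≅T ΣT (λ i → weight (ss i) · type (ss i))) × (Σs (λ i → weight (ss i)) ≈ 1#)
  abstraction-decomposition ⊢λ =
    let s , ss , T≅ , total≈1 = generation ⊢λ abs in
    length ss , lookup (s ∷ ss) ,
    subst (_ ≅T_) (sym (ΣT-lookup s ss)) T≅ , subst (_≈ 1#) (sym (Σs-lookup s ss)) total≈1

mainTheorem13 : ∀ {c ℓ} (Ring : CommutativeRing c ℓ) →
    let open Lambda Ring in
    ∀ (Γ : Ctx) (x : ℕ) (t : Tm) (T : Ty) →
       Γ ⊢ ƛ x t ⦂ T →
       ∃[ n ] Σ (Fin (suc n) → Ty) λ Ts → Σ (Fin (suc n) → Ty) λ Rs →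
         Σ (Fin (suc n) → UTy) λ Us → Σ (Fin (suc n) → S) λ αs →
         Σ (Fin (suc n) → List TV) λ 𝒱s →
           (T ≅T ΣT (λ i → αs i · Ts i))
           × (Σs αs ≈ 1#)
           × (∀ i → ((x , Us i) ∷ Γ ⊢ t ⦂ Rs i)
                    × (⌜ Us i ⇒ Rs i ⌝ ⪯[ 𝒱s i , Γ ] Ts i))
mainTheorem13 Ring Γ x t T ⊢λ =
  let open Generation Ring Γ x t
      n , ss , T≅ , Σα≈1 = abstraction-decomposition ⊢λ
  in n , type ∘ ss , cod ∘ ss , dom ∘ ss , weight ∘ ss , vars ∘ ss ,
     T≅ , Σα≈1 , λ i → body (ss i) , order (ss i)
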